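{- For each $n,m\ge 0$, \[ |\mathcal{G}^{01}_m[n]|=\frac{1}{n!}\sum_{k=0}^n(-1)^{n-k}{n\brack k}\,\mathrm{fub}(k)\,m^k \quad\text{and}\quad |\mathcal{M}^{01}[n]|=\frac{1}{n!}\sum_{k=0}^n(-1)^{n-k}{n\brack k}\,\mathrm{fub}(k)^2. \]
   Context: $|\mathcal{G}^{01}_m[n]|$ is the number of matrices with $m$ rows (and any number of columns) with entries in $\{0,1\}$, exactly $n$ entries equal to $1$, and no zero column. $\mathcal{M}^{01}[n]$ is the set of binary Burge matrices of size $n$: matrices (any numbers of rows and columns) with entries in $\{0,1\}$, exactly $n$ ones, and no zero row and no zero column. ${n\brack k}$ is the unsigned Stirling number of the first kind and $\mathrm{fub}(k)$ the Fubini number (number of ordered set partitions of $\{1,\dots,k\}$, $\mathrm{fub}(0)=1$). -}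

module Defs where

open import Data.Nat using (ℕ; zero; suc; _+_; _*_; _∸_; _^_; _≤_)
import Data.Nat
import Data.Nat.ListAction
open import Data.Nat using (_!)
open import Data.Bool using (Bool; true; false; _∧_; if_then_else_)
open import Data.List as L using (List; []; _∷_; length; filterᵇ; concatMap; upTo; map; allFin)
open import Data.Vec as V using (Vec; []; _∷_)
open import Data.Fin using (Fin)
open import Data.Fin.Properties using (_≟_)
open import Relation.Nullary.Decidable using (⌊_⌋)
open import Data.Integer as ℤ using (ℤ; +_; -_)

vecs : {A : Set} → List A → (k : ℕ) → List (Vec A k)
vecs xs zero    = [] ∷ []
vecs xs (suc k) = concatMap (λ x → map (x ∷_) (vecs xs k)) xs

count : {A : Set} → (A → Bool) → List A → ℕ
count p xs = length (filterᵇ p xs)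

Σℕ : ℕ → (ℕ → ℕ) → ℕ
Σℕ n f = Data.Nat.ListAction.sum (map f (upTo (suc n)))

Σℤ : ℕ → (ℕ → ℤ) → ℤ
Σℤ n f = L.foldr ℤ._+_ (+ 0) (map f (upTo (suc n)))

Mat01 : ℕ → ℕ → Set
Mat01 r c = Vec (Vec Bool c) r

allMat01 : (r c : ℕ) → List (Mat01 r c)
allMat01 r c = vecs (vecs (true ∷ false ∷ []) c) r

anyᵥ : {A : Set} {k : ℕ} → (A → Bool) → Vec A k → Bool
anyᵥ p []       = false
anyᵥ p (x ∷ xs) = if p x then true else anyᵥ p xs

allᵥ : {A : Set} {k : ℕ} → (A → Bool) → Vec A k → Bool
allᵥ p []       = true
allᵥ p (x ∷ xs) = p x ∧ allᵥ p xs

isOne : Bool → Bool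
isOne b = b

onesRow : {c : ℕ} → Vec Bool c → ℕ
onesRow []           = 0
onesRow (true  ∷ bs) = suc (onesRow bs)
onesRow (false ∷ bs) = onesRow bs

ones : {r c : ℕ} → Mat01 r c → ℕ
ones []         = 0
ones (row ∷ rs) = onesRow row + ones rs

nonzero : {c : ℕ} → Vec Bool c → Bool
nonzero = anyᵥ isOne

noZeroRow : {r c : ℕ} → Mat01 r c → Bool
noZeroRow M = allᵥ nonzero M

noZeroCol : {r c : ℕ} → Mat01 r c → Bool
noZeroCol M = allᵥ nonzero (V.transpose M)

ℕ-eqᵇ : ℕ → ℕ → Bool
ℕ-eqᵇ m n = ⌊ m Data.Nat.≟ n ⌋

G-cols : (m n c : ℕ) → ℕ
G-cols m n c = count (λ M → ℕ-eqᵇ (ones M) n ∧ noZeroCol M) (allMat01 m c)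

-- |G^{01}_m[n]| computed by letting the number of columns c range over 0..N.
-- (Any N ≥ n captures all such matrices, since each column contains a 1.)
G01 : (m n N : ℕ) → ℕ
G01 m n N = Σℕ N (G-cols m n)

M-rc : (n r c : ℕ) → ℕ
M-rc n r c = count (λ M → ℕ-eqᵇ (ones M) n ∧ noZeroRow M ∧ noZeroCol M) (allMat01 r c)

-- |M^{01}[n]| with rows and columns ranging over 0..N (any N ≥ n suffices).
M01 : (n N : ℕ) → ℕ
M01 n N = Σℕ N (λ r → Σℕ N (λ c → M-rc n r c))

stirling1 : ℕ → ℕ → ℕ
stirling1 zero    zero    = 1
stirling1 zero    (suc k) = 0
stirling1 (suc n) zero    = 0
stirling1 (suc n) (suc k) = n * stirling1 n (suc k) + stirling1 n k

isSurjective : {k j : ℕ} → Vec (Fin j) k → Bool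
isSurjective {k} {j} v =
  L.foldr _∧_ true (map (λ y → anyᵥ (λ x → ⌊ x ≟ y ⌋) v) (allFin j))

-- Ordered set partitions of {1..k} into j blocks ↔ surjections Fin k → Fin j
-- (block i = preimage of i). fub k = Σ_{j=0}^{k} #surjections Fin k ↠ Fin j.
fub : ℕ → ℕ
fub k = Σℕ k (λ j → count isSurjective (vecs (allFin j) k))

altSum : ℕ → (ℕ → ℕ) → ℤ
altSum n w = Σℤ n (λ k → ((- (+ 1)) ℤ.^ (n ∸ k)) ℤ.* (+ (stirling1 n k * fub k * w k)))

{-# OPTIONS --safe #-}
-- Both counts are finite differences at 0.  Building a matrix column by column and excluding zero
-- columns by inclusion–exclusion, the m × c matrices with n ones and no zero column number
-- Δᶜⱼ C(mj, n); building it row by row in the same way, those with no zero row and no zero column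
-- number Δʳᵢ of the former count for i × c matrices.  Now n!·C(x, n) = x(x-1)⋯(x-n+1) = ∑ₖ s(n,k) xᵏ
-- with the signed Stirling numbers s(n,k) = (-1)^(n-k) [n k], and Δᶜⱼ jᵏ counts the surjections from
-- a k-set onto a c-set.  These vanish for c > k and sum over c to fub k, so summing over the columns
-- (and the rows) leaves ∑ₖ s(n,k) fub(k) mᵏ and ∑ₖ s(n,k) fub(k)².
module Submission where

open import Function using (_∘_)
open import Data.Bool using (Bool; true; false; _∧_; _∨_; if_then_else_)
import Data.Bool.Properties as 𝔹
open import Data.Bool.ListAction using (all; and)
open import Data.Nat as ℕ using (ℕ; zero; suc; _≤_; _<_; z≤n; s≤s; _!; _∸_)
import Data.Nat.Properties as ℕ
open import Data.Nat.Combinatorics using (_C_; nCk+nC[k+1]≡[n+1]C[k+1]; nC1≡n)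
import Data.Nat.ListAction as ℕ
open import Data.Integer as ℤ using (ℤ; +_; -_; _+_; _*_; _-_; _^_)
import Data.Integer.Properties as ℤ
open import Data.Integer.Tactic.RingSolver using (solve-∀)
open import Data.Nat.Tactic.RingSolver using () renaming (solve-∀ to ℕ-solve-∀)
open import Data.List as List using (List; []; _∷_; _++_; [_]; map; foldr; concatMap; upTo; allFin)
import Data.List.Properties as List
open import Data.Vec as Vec using (Vec; []; _∷_; zipWith; replicate)
import Data.Vec.Properties as Vec
open import Data.Fin as Fin using (Fin)
open import Data.Fin.Properties using (_≟_)
open import Data.Product using (_×_; _,_)
open import Data.Sum using (inj₁; inj₂)
open import Relation.Binary.PropositionalEquality using (_≡_; refl; sym; trans; cong; cong₂; module ≡-Reasoning)
open import Relation.Nullary.Decidable using (⌊_⌋; yes; no; isYes≗does)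
open import Defs
import Algebra.Properties.CommutativeSemigroup ℕ.+-commutativeSemigroup as ℕ+
import Algebra.Properties.CommutativeSemigroup ℤ.+-commutativeSemigroup as ℤ+
import Algebra.Properties.CommutativeSemigroup ℤ.*-commutativeSemigroup as ℤ*

open ≡-Reasoning

private
  variable
    A B : Set

-- Finite sums

infix 5 ∑ ∑<

∑ : List A → (A → ℤ) → ℤ
∑ xs f = foldr _+_ (+ 0) (map f xs)

syntax ∑ xs (λ x → e) = ∑[ x ∈ xs ] e

∑< : ℕ → (ℕ → ℤ) → ℤ
∑< n f = ∑ (upTo n) f

syntax ∑< n (λ i → e) = ∑[ i < n ] e

∑-cong : ∀ (xs : List A) {f g : A → ℤ} → (∀ x → f x ≡ g x) → ∑ xs f ≡ ∑ xs g
∑-cong xs f≗g = cong (foldr _+_ (+ 0)) (List.map-cong f≗g xs)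

∑-++ : ∀ (xs ys : List A) f → ∑ (xs ++ ys) f ≡ ∑ xs f + ∑ ys f
∑-++ []       ys f = sym (ℤ.+-identityˡ _)
∑-++ (x ∷ xs) ys f = trans (cong (_+_ (f x)) (∑-++ xs ys f)) (sym (ℤ.+-assoc (f x) _ _))

∑-map : ∀ (h : A → B) xs f → ∑ (map h xs) f ≡ ∑ xs (f ∘ h)
∑-map h xs f = cong (foldr _+_ (+ 0)) (sym (List.map-∘ xs))

∑-concatMap : ∀ (g : A → List B) xs f → ∑ (concatMap g xs) f ≡ ∑[ x ∈ xs ] ∑ (g x) f
∑-concatMap g []       f = refl
∑-concatMap g (x ∷ xs) f = trans (∑-++ (g x) _ f) (cong (_+_ (∑ (g x) f)) (∑-concatMap g xs f))

∑-zero : ∀ (xs : List A) → ∑[ x ∈ xs ] + 0 ≡ + 0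
∑-zero []       = refl
∑-zero (x ∷ xs) = trans (ℤ.+-identityˡ _) (∑-zero xs)

∑-+ : ∀ (xs : List A) f g → ∑[ x ∈ xs ] (f x + g x) ≡ ∑ xs f + ∑ xs g
∑-+ []       f g = refl
∑-+ (x ∷ xs) f g = trans (cong (_+_ (f x + g x)) (∑-+ xs f g)) (ℤ+.interchange (f x) (g x) _ _)

∑-*ˡ : ∀ (xs : List A) a f → ∑[ x ∈ xs ] a * f x ≡ a * ∑ xs f
∑-*ˡ []       a f = sym (ℤ.*-zeroʳ a)
∑-*ˡ (x ∷ xs) a f = trans (cong (_+_ (a * f x)) (∑-*ˡ xs a f)) (sym (ℤ.*-distribˡ-+ a (f x) _))

∑-swap : ∀ (xs : List A) (ys : List B) (f : A → B → ℤ) →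
         ∑[ x ∈ xs ] ∑[ y ∈ ys ] f x y ≡ ∑[ y ∈ ys ] ∑[ x ∈ xs ] f x y
∑-swap []       ys f = sym (∑-zero ys)
∑-swap (x ∷ xs) ys f =
  trans (cong (_+_ (∑ ys (f x))) (∑-swap xs ys f)) (sym (∑-+ ys (f x) (λ y → ∑[ x ∈ xs ] f x y)))

∑-vecs-suc : ∀ (xs : List A) k (f : Vec A (suc k) → ℤ) →
             ∑ (vecs xs (suc k)) f ≡ ∑[ x ∈ xs ] ∑[ v ∈ vecs xs k ] f (x ∷ v)
∑-vecs-suc xs k f = trans (∑-concatMap (λ x → map (x ∷_) (vecs xs k)) xs f)
                          (∑-cong xs (λ x → ∑-map (x ∷_) (vecs xs k) f))

∑<-suc : ∀ n f → ∑[ i < suc n ] f i ≡ f 0 + (∑[ i < n ] f (suc i))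
∑<-suc n f = cong (λ xs → f 0 + foldr _+_ (+ 0) xs)
  (trans (List.map-applyUpTo suc f n) (sym (List.map-upTo (f ∘ suc) n)))

∑<-last : ∀ n f → ∑[ i < suc n ] f i ≡ (∑[ i < n ] f i) + f n
∑<-last n f = begin
  ∑ (upTo (suc n)) f        ≡⟨ cong (λ xs → ∑ xs f) (sym (List.upTo-∷ʳ n)) ⟩
  ∑ (upTo n ++ [ n ]) f     ≡⟨ ∑-++ (upTo n) [ n ] f ⟩
  ∑< n f + (f n + + 0)      ≡⟨ cong (_+_ (∑< n f)) (ℤ.+-identityʳ (f n)) ⟩
  ∑< n f + f n              ∎

∑<-cong : ∀ n {f g : ℕ → ℤ} → (∀ i → i < n → f i ≡ g i) → ∑< n f ≡ ∑< n g
∑<-cong zero    f≗g = refl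
∑<-cong (suc n) {f} {g} f≗g = begin
  ∑< (suc n) f        ≡⟨ ∑<-last n f ⟩
  ∑< n f + f n        ≡⟨ cong₂ _+_ (∑<-cong n (λ i i<n → f≗g i (ℕ.m<n⇒m<1+n i<n))) (f≗g n ℕ.≤-refl) ⟩
  ∑< n g + g n        ≡⟨ sym (∑<-last n g) ⟩
  ∑< (suc n) g        ∎

∑<-truncate : ∀ {n N} f → n ≤ N → (∀ i → n ≤ i → f i ≡ + 0) → ∑< N f ≡ ∑< n f
∑<-truncate {N = zero}  f z≤n vanish = refl
∑<-truncate {n} {N = suc N} f n≤N vanish with ℕ.m≤n⇒m<n∨m≡n n≤N
... | inj₂ refl        = refl
... | inj₁ (s≤s n≤N-1) = begin
  ∑< (suc N) f   ≡⟨ ∑<-last N f ⟩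
  ∑< N f + f N   ≡⟨ cong₂ _+_ (∑<-truncate f n≤N-1 vanish) (vanish N n≤N-1) ⟩
  ∑< n f + + 0   ≡⟨ ℤ.+-identityʳ _ ⟩
  ∑< n f         ∎

𝟙 : Bool → ℤ
𝟙 true  = + 1
𝟙 false = + 0

pos-count : ∀ (p : A → Bool) xs → + count p xs ≡ ∑[ x ∈ xs ] 𝟙 (p x)
pos-count p []       = refl
pos-count p (x ∷ xs) with p x
... | true  = trans (ℤ.pos-+ 1 (count p xs)) (cong (_+_ (+ 1)) (pos-count p xs))
... | false = trans (pos-count p xs) (sym (ℤ.+-identityˡ _))

pos-sum : ∀ xs → + ℕ.sum xs ≡ ∑[ x ∈ xs ] + x
pos-sum []       = refl
pos-sum (x ∷ xs) = trans (ℤ.pos-+ x _) (cong (_+_ (+ x)) (pos-sum xs))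

pos-Σℕ : ∀ N f → + Σℕ N f ≡ ∑[ i < suc N ] + f i
pos-Σℕ N f = trans (pos-sum (map f (upTo (suc N)))) (∑-map f (upTo (suc N)) (λ x → + x))

pos-^ : ∀ m k → + (m ℕ.^ k) ≡ (+ m) ^ k
pos-^ m zero    = refl
pos-^ m (suc k) = trans (ℤ.pos-* m (m ℕ.^ k)) (cong (+ m *_) (pos-^ m k))

-- Finite differences

-- Δ r f is the r-th forward difference of f at 0, that is ∑ₖ (-1)^(r-k) (r choose k) f k.
Δ : ℕ → (ℕ → ℤ) → ℤ
Δ zero    f = f 0
Δ (suc r) f = Δ r (f ∘ suc) - Δ r f

Δ-cong : ∀ r {f g : ℕ → ℤ} → (∀ i → f i ≡ g i) → Δ r f ≡ Δ r g
Δ-cong zero    f≗g = f≗g 0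
Δ-cong (suc r) f≗g = cong₂ _-_ (Δ-cong r (f≗g ∘ suc)) (Δ-cong r f≗g)

Δ-zero : ∀ r → Δ r (λ _ → + 0) ≡ + 0
Δ-zero zero    = refl
Δ-zero (suc r) = cong₂ _-_ (Δ-zero r) (Δ-zero r)

Δ-const : ∀ r a → Δ (suc r) (λ _ → a) ≡ + 0
Δ-const r a = ℤ.+-inverseʳ (Δ r (λ _ → a))

Δ-+ : ∀ r f g → Δ r (λ i → f i + g i) ≡ Δ r f + Δ r g
Δ-+ zero    f g = refl
Δ-+ (suc r) f g =
  trans (cong₂ _-_ (Δ-+ r (f ∘ suc) (g ∘ suc)) (Δ-+ r f g))
        (regroup (Δ r (f ∘ suc)) (Δ r (g ∘ suc)) (Δ r f) (Δ r g))
  where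
  regroup : ∀ a b c d → (a + b) - (c + d) ≡ (a - c) + (b - d)
  regroup = solve-∀

Δ-*ˡ : ∀ r a f → Δ r (λ i → a * f i) ≡ a * Δ r f
Δ-*ˡ zero    a f = refl
Δ-*ˡ (suc r) a f =
  trans (cong₂ _-_ (Δ-*ˡ r a (f ∘ suc)) (Δ-*ˡ r a f)) (factor a (Δ r (f ∘ suc)) (Δ r f))
  where
  factor : ∀ a b c → a * b - a * c ≡ a * (b - c)
  factor = solve-∀

Δ-- : ∀ r f g → Δ r (λ i → f i - g i) ≡ Δ r f - Δ r g
Δ-- r f g = begin
  Δ r (λ i → f i - g i)                 ≡⟨ Δ-+ r f (λ i → - g i) ⟩
  Δ r f + Δ r (λ i → - g i)             ≡⟨ cong (_+_ (Δ r f)) (Δ-cong r (λ i → sym (ℤ.-1*i≡-i (g i)))) ⟩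
  Δ r f + Δ r (λ i → - + 1 * g i)       ≡⟨ cong (_+_ (Δ r f)) (trans (Δ-*ˡ r (- + 1) g) (ℤ.-1*i≡-i (Δ r g))) ⟩
  Δ r f - Δ r g                         ∎

Δ-∑ : ∀ r (xs : List A) (f : A → ℕ → ℤ) → Δ r (λ i → ∑[ x ∈ xs ] f x i) ≡ ∑[ x ∈ xs ] Δ r (f x)
Δ-∑ r []       f = Δ-zero r
Δ-∑ r (x ∷ xs) f = trans (Δ-+ r (f x) _) (cong (_+_ (Δ r (f x))) (Δ-∑ r xs f))

Δ-i* : ∀ r f → Δ r (λ i → + i * f i) ≡ + r * Δ (ℕ.pred r) (f ∘ suc)
Δ-i* zero          f = trans (ℤ.*-zeroˡ (f 0)) (sym (ℤ.*-zeroˡ (f 1)))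
Δ-i* (suc zero)    f = drop-zero (f 1) (f 0)
  where
  drop-zero : ∀ a b → + 1 * a - + 0 * b ≡ + 1 * a
  drop-zero = solve-∀
Δ-i* (suc (suc r)) f = begin
  Δ (suc r) (λ i → + suc i * f (suc i)) - Δ (suc r) (λ i → + i * f i)
    ≡⟨ cong (_- Δ (suc r) (λ i → + i * f i)) (Δ-cong (suc r) (λ i → split (+ i) (f (suc i)))) ⟩
  Δ (suc r) (λ i → f (suc i) + + i * f (suc i)) - Δ (suc r) (λ i → + i * f i)
    ≡⟨ cong (_- Δ (suc r) (λ i → + i * f i)) (Δ-+ (suc r) (f ∘ suc) (λ i → + i * f (suc i))) ⟩
  Δ (suc r) (f ∘ suc) + Δ (suc r) (λ i → + i * f (suc i)) - Δ (suc r) (λ i → + i * f i)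
    ≡⟨ cong₂ (λ a b → Δ (suc r) (f ∘ suc) + a - b) (Δ-i* (suc r) (f ∘ suc)) (Δ-i* (suc r) f) ⟩
  Δ (suc r) (f ∘ suc) + + suc r * Δ r (f ∘ suc ∘ suc) - + suc r * Δ r (f ∘ suc)
    ≡⟨ collect (+ r) (Δ r (f ∘ suc ∘ suc)) (Δ r (f ∘ suc)) ⟩
  + suc (suc r) * Δ (suc r) (f ∘ suc) ∎
  where
  split : ∀ i x → (+ 1 + i) * x ≡ x + i * x
  split = solve-∀
  collect : ∀ r a b → (a - b) + (+ 1 + r) * a - (+ 1 + r) * b ≡ (+ 1 + (+ 1 + r)) * (a - b)
  collect = solve-∀

shiftedPower : ℕ → ℕ → ℕ → ℤ
shiftedPower a k i = (+ (a ℕ.+ i)) ^ k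

Δ-shiftedPower-suc : ∀ r a k →
  Δ r (shiftedPower a (suc k)) ≡ + a * Δ r (shiftedPower a k) + + r * Δ (ℕ.pred r) (shiftedPower (suc a) k)
Δ-shiftedPower-suc r a k = begin
  Δ r (shiftedPower a (suc k))
    ≡⟨ Δ-cong r (λ i → ℤ.*-distribʳ-+ (shiftedPower a k i) (+ a) (+ i)) ⟩
  Δ r (λ i → + a * shiftedPower a k i + + i * shiftedPower a k i)
    ≡⟨ Δ-+ r _ _ ⟩
  Δ r (λ i → + a * shiftedPower a k i) + Δ r (λ i → + i * shiftedPower a k i)
    ≡⟨ cong₂ _+_ (Δ-*ˡ r (+ a) (shiftedPower a k)) (Δ-i* r (shiftedPower a k)) ⟩
  + a * Δ r (shiftedPower a k) + + r * Δ (ℕ.pred r) (shiftedPower a k ∘ suc)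
    ≡⟨ cong (λ d → + a * Δ r (shiftedPower a k) + + r * d)
            (Δ-cong (ℕ.pred r) (λ i → cong (λ j → (+ j) ^ k) (ℕ.+-suc a i))) ⟩
  + a * Δ r (shiftedPower a k) + + r * Δ (ℕ.pred r) (shiftedPower (suc a) k) ∎

Δ-shiftedPower-vanish : ∀ {k r} a → k < r → Δ r (shiftedPower a k) ≡ + 0
Δ-shiftedPower-vanish {zero}  {suc r} a _          = Δ-const r (+ 1)
Δ-shiftedPower-vanish {suc k} {suc r} a (s≤s k<r) = begin
  Δ (suc r) (shiftedPower a (suc k))
    ≡⟨ Δ-shiftedPower-suc (suc r) a k ⟩
  + a * Δ (suc r) (shiftedPower a k) + + suc r * Δ r (shiftedPower (suc a) k)
    ≡⟨ cong₂ (λ x y → + a * x + + suc r * y)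
             (Δ-shiftedPower-vanish a (ℕ.m<n⇒m<1+n k<r)) (Δ-shiftedPower-vanish (suc a) k<r) ⟩
  + a * + 0 + + suc r * + 0
    ≡⟨ cong₂ _+_ (ℤ.*-zeroʳ (+ a)) (ℤ.*-zeroʳ (+ suc r)) ⟩
  + 0 ∎

-- Surjections

surjections : ℕ → ℕ → ℕ
surjections k c = count isSurjective (vecs (allFin c) k)

map-allFin-suc : ∀ {c} (f : Fin (suc c) → A) →
                 map f (allFin (suc c)) ≡ f Fin.zero ∷ map (f ∘ Fin.suc) (allFin c)
map-allFin-suc f = cong (f Fin.zero ∷_)
  (trans (List.map-tabulate Fin.suc f) (sym (List.map-tabulate (λ y → y) (f ∘ Fin.suc))))

∑-allFin-suc : ∀ {c} (f : Fin (suc c) → ℤ) →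
               ∑ (allFin (suc c)) f ≡ f Fin.zero + ∑ (allFin c) (f ∘ Fin.suc)
∑-allFin-suc f = cong (foldr _+_ (+ 0)) (map-allFin-suc f)

all-allFin-suc : ∀ {c} (p : Fin (suc c) → Bool) →
                 all p (allFin (suc c)) ≡ p Fin.zero ∧ all (p ∘ Fin.suc) (allFin c)
all-allFin-suc p = cong and (map-allFin-suc p)

all-cong : ∀ (xs : List A) {p q : A → Bool} → (∀ x → p x ≡ q x) → all p xs ≡ all q xs
all-cong xs p≗q = cong and (List.map-cong p≗q xs)

hits : ∀ {c k} → Vec (Fin c) k → Fin c → Bool
hits w y = anyᵥ (λ x → ⌊ x ≟ y ⌋) w

covers : ∀ {c k} → (Fin c → Bool) → Vec (Fin c) k → Bool
covers {c} S w = all (λ y → S y ∨ hits w y) (allFin c)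

insert : ∀ {c} → Fin c → (Fin c → Bool) → Fin c → Bool
insert x S y = ⌊ x ≟ y ⌋ ∨ S y

covers-∷ : ∀ {c k} S x (w : Vec (Fin c) k) → covers S (x ∷ w) ≡ covers (insert x S) w
covers-∷ {c} S x w = all-cong (allFin c) (λ y → ∨-if (S y) ⌊ x ≟ y ⌋ (hits w y))
  where
  ∨-if : ∀ s e h → (s ∨ (if e then true else h)) ≡ (e ∨ s) ∨ h
  ∨-if true  true  h = refl
  ∨-if true  false h = refl
  ∨-if false true  h = refl
  ∨-if false false h = refl

insert-suc : ∀ {c} x (S : Fin (suc c) → Bool) y →
             insert (Fin.suc x) S (Fin.suc y) ≡ insert x (S ∘ Fin.suc) y
insert-suc x S y = cong (_∨ S (Fin.suc y))
  (trans (isYes≗does (Fin.suc x ≟ Fin.suc y)) (sym (isYes≗does (x ≟ y))))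

insert-covered : ∀ {c} (S : Fin c → Bool) x → S x ≡ true → ∀ y → insert x S y ≡ S y
insert-covered S x Sx y with x ≟ y
... | yes refl = sym Sx
... | no  _    = refl

#true #false : ∀ {c} → (Fin c → Bool) → ℕ
#true  {zero}  S = 0
#true  {suc c} S = (if S Fin.zero then 1 else 0) ℕ.+ #true (S ∘ Fin.suc)
#false {zero}  S = 0
#false {suc c} S = (if S Fin.zero then 0 else 1) ℕ.+ #false (S ∘ Fin.suc)

#true-cong : ∀ {c} {S T : Fin c → Bool} → (∀ y → S y ≡ T y) → #true S ≡ #true T
#true-cong {zero}  S≗T = refl
#true-cong {suc c} S≗T =
  cong₂ ℕ._+_ (cong (λ b → if b then 1 else 0) (S≗T Fin.zero)) (#true-cong (S≗T ∘ Fin.suc))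

#false-cong : ∀ {c} {S T : Fin c → Bool} → (∀ y → S y ≡ T y) → #false S ≡ #false T
#false-cong {zero}  S≗T = refl
#false-cong {suc c} S≗T =
  cong₂ ℕ._+_ (cong (λ b → if b then 0 else 1) (S≗T Fin.zero)) (#false-cong (S≗T ∘ Fin.suc))

#true-insert : ∀ {c} (S : Fin c → Bool) x → S x ≡ false → #true (insert x S) ≡ suc (#true S)
#true-insert {suc c} S Fin.zero    Sx rewrite Sx = refl
#true-insert {suc c} S (Fin.suc x) Sx = trans
  (cong ((if S Fin.zero then 1 else 0) ℕ.+_)
        (trans (#true-cong (insert-suc x S)) (#true-insert (S ∘ Fin.suc) x Sx)))
  (ℕ.+-suc _ _)

#false-insert : ∀ {c} (S : Fin c → Bool) x → S x ≡ false → #false S ≡ suc (#false (insert x S))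
#false-insert {suc c} S Fin.zero    Sx rewrite Sx = refl
#false-insert {suc c} S (Fin.suc x) Sx = trans
  (cong ((if S Fin.zero then 0 else 1) ℕ.+_)
        (trans (#false-insert (S ∘ Fin.suc) x Sx) (cong suc (#false-cong (λ y → sym (insert-suc x S y))))))
  (ℕ.+-suc _ _)

#true-none : ∀ c → #true {c} (λ _ → false) ≡ 0
#true-none zero    = refl
#true-none (suc c) = #true-none c

#false-none : ∀ c → #false {c} (λ _ → false) ≡ c
#false-none zero    = refl
#false-none (suc c) = cong suc (#false-none c)

∑-allFin-if : ∀ {c} (S : Fin c → Bool) a b →
       ∑[ x ∈ allFin c ] (if S x then a else b) ≡ + #true S * a + + #false S * b
∑-allFin-if {zero}  S a b = sym (cong₂ _+_ (ℤ.*-zeroˡ a) (ℤ.*-zeroˡ b))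
∑-allFin-if {suc c} S a b = trans (∑-allFin-suc (λ x → if S x then a else b)) (split (S Fin.zero))
  where
  t = #true (S ∘ Fin.suc)
  f = #false (S ∘ Fin.suc)
  rest : ∑[ x ∈ allFin c ] (if S (Fin.suc x) then a else b) ≡ + t * a + + f * b
  rest = ∑-allFin-if (S ∘ Fin.suc) a b
  split : ∀ s → (if s then a else b) + (∑[ x ∈ allFin c ] (if S (Fin.suc x) then a else b))
                ≡ + ((if s then 1 else 0) ℕ.+ t) * a + + ((if s then 0 else 1) ℕ.+ f) * b
  split true  = trans (cong (_+_ a) rest) (count-a (+ t) (+ f) a b)
    where
    count-a : ∀ t f a b → a + (t * a + f * b) ≡ (+ 1 + t) * a + f * b
    count-a = solve-∀
  split false = trans (cong (_+_ b) rest) (count-b (+ t) (+ f) a b)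
    where
    count-b : ∀ t f a b → b + (t * a + f * b) ≡ t * a + (+ 1 + f) * b
    count-b = solve-∀

coverings : ∀ {c} → ℕ → (Fin c → Bool) → ℤ
coverings {c} k S = ∑[ w ∈ vecs (allFin c) k ] 𝟙 (covers S w)

coverings-suc : ∀ {c} k (S : Fin c → Bool) → coverings (suc k) S ≡ ∑[ x ∈ allFin c ] coverings k (insert x S)
coverings-suc {c} k S = trans (∑-vecs-suc (allFin c) k (λ w → 𝟙 (covers S w)))
  (∑-cong (allFin c) (λ x → ∑-cong (vecs (allFin c) k) (λ w → cong 𝟙 (covers-∷ S x w))))

covers-[] : ∀ {c} (S : Fin c → Bool) → 𝟙 (covers S []) ≡ Δ (#false S) (λ _ → + 1)
covers-[] {zero}  S = refl
covers-[] {suc c} S rewrite all-allFin-suc (λ y → S y ∨ false) with S Fin.zero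
... | true  = covers-[] (S ∘ Fin.suc)
... | false = sym (Δ-const (#false (S ∘ Fin.suc)) (+ 1))

-- The first point of w either hits one of the o covered points, leaving S as it is, or one of the
-- z uncovered ones, leaving o + 1 covered and z - 1 uncovered: this is the recursion of Δ-shiftedPower-suc.
coverings≡Δ : ∀ {c} k (S : Fin c → Bool) → coverings k S ≡ Δ (#false S) (shiftedPower (#true S) k)
coverings≡Δ zero    S = trans (ℤ.+-identityʳ _) (covers-[] S)
coverings≡Δ {c} (suc k) S = begin
  coverings (suc k) S                           ≡⟨ coverings-suc k S ⟩
  ∑[ x ∈ allFin c ] coverings k (insert x S)    ≡⟨ ∑-cong (allFin c) by-cases ⟩
  ∑[ x ∈ allFin c ] (if S x then a else b)      ≡⟨ ∑-allFin-if S a b ⟩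
  + o * a + + z * b                             ≡⟨ sym (Δ-shiftedPower-suc z o k) ⟩
  Δ z (shiftedPower o (suc k))                  ∎
  where
  o = #true S
  z = #false S
  a = Δ z (shiftedPower o k)
  b = Δ (ℕ.pred z) (shiftedPower (suc o) k)
  by-cases : ∀ x → coverings k (insert x S) ≡ (if S x then a else b)
  by-cases x with S x in Sx
  ... | true  = trans (coverings≡Δ k (insert x S))
                      (cong₂ (λ z′ o′ → Δ z′ (shiftedPower o′ k))
                             (#false-cong (insert-covered S x Sx)) (#true-cong (insert-covered S x Sx)))
  ... | false = trans (coverings≡Δ k (insert x S))
                      (cong₂ (λ z′ o′ → Δ z′ (shiftedPower o′ k))
                             (cong ℕ.pred (sym (#false-insert S x Sx))) (#true-insert S x Sx))

surjections≡Δ : ∀ k c → + surjections k c ≡ Δ c (λ i → (+ i) ^ k)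
surjections≡Δ k c = begin
  + surjections k c           ≡⟨ pos-count isSurjective (vecs (allFin c) k) ⟩
  coverings k none            ≡⟨ coverings≡Δ k none ⟩
  Δ (#false none) (shiftedPower (#true none) k)
    ≡⟨ cong₂ (λ z o → Δ z (shiftedPower o k)) (#false-none c) (#true-none c) ⟩
  Δ c (λ i → (+ i) ^ k)       ∎
  where
  none : Fin c → Bool
  none _ = false

surjections-vanish : ∀ {k c} → k < c → + surjections k c ≡ + 0
surjections-vanish {k} {c} k<c = trans (surjections≡Δ k c) (Δ-shiftedPower-vanish 0 k<c)

∑-surjections≡fub : ∀ {k N} → k ≤ N → ∑[ c < suc N ] + surjections k c ≡ + fub k
∑-surjections≡fub {k} {N} k≤N = begin
  ∑[ c < suc N ] + surjections k c
    ≡⟨ ∑<-truncate (λ c → + surjections k c) (s≤s k≤N) (λ c → surjections-vanish) ⟩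
  ∑[ c < suc k ] + surjections k c
    ≡⟨ sym (pos-Σℕ k (surjections k)) ⟩
  + fub k ∎

-- Binomial coefficients, falling factorials and Stirling numbers

binomial-absorption : ∀ x n → suc n ℕ.* (x C suc n) ℕ.+ n ℕ.* (x C n) ≡ x ℕ.* (x C n)
binomial-absorption zero    zero    = refl
binomial-absorption zero    (suc n) = cong₂ ℕ._+_ (ℕ.*-zeroʳ (suc (suc n))) (ℕ.*-zeroʳ (suc n))
binomial-absorption (suc x) zero    =
  trans (ℕ.+-identityʳ _) (trans (ℕ.*-identityˡ _) (trans (nC1≡n (suc x)) (sym (ℕ.*-identityʳ (suc x)))))
binomial-absorption (suc x) (suc n) = begin
  suc (suc n) ℕ.* (suc x C suc (suc n)) ℕ.+ suc n ℕ.* (suc x C suc n)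
    ≡⟨ cong₂ (λ p q → suc (suc n) ℕ.* p ℕ.+ suc n ℕ.* q)
             (sym (nCk+nC[k+1]≡[n+1]C[k+1] x (suc n))) (sym (nCk+nC[k+1]≡[n+1]C[k+1] x n)) ⟩
  suc (suc n) ℕ.* (b ℕ.+ c) ℕ.+ suc n ℕ.* (a ℕ.+ b)
    ≡⟨ regroup n a b c ⟩
  (suc (suc n) ℕ.* c ℕ.+ suc n ℕ.* b) ℕ.+ (suc n ℕ.* b ℕ.+ n ℕ.* a) ℕ.+ (a ℕ.+ b)
    ≡⟨ cong₂ (λ p q → p ℕ.+ q ℕ.+ (a ℕ.+ b)) (binomial-absorption x (suc n)) (binomial-absorption x n) ⟩
  x ℕ.* b ℕ.+ x ℕ.* a ℕ.+ (a ℕ.+ b)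
    ≡⟨ collect x a b ⟩
  suc x ℕ.* (a ℕ.+ b)
    ≡⟨ cong (suc x ℕ.*_) (nCk+nC[k+1]≡[n+1]C[k+1] x n) ⟩
  suc x ℕ.* (suc x C suc n) ∎
  where
  a = x C n
  b = x C suc n
  c = x C suc (suc n)
  regroup : ∀ n a b c → suc (suc n) ℕ.* (b ℕ.+ c) ℕ.+ suc n ℕ.* (a ℕ.+ b)
                        ≡ (suc (suc n) ℕ.* c ℕ.+ suc n ℕ.* b) ℕ.+ (suc n ℕ.* b ℕ.+ n ℕ.* a) ℕ.+ (a ℕ.+ b)
  regroup = ℕ-solve-∀
  collect : ∀ x a b → x ℕ.* b ℕ.+ x ℕ.* a ℕ.+ (a ℕ.+ b) ≡ suc x ℕ.* (a ℕ.+ b)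
  collect = ℕ-solve-∀

fallingFactorial : ℤ → ℕ → ℤ
fallingFactorial x zero    = + 1
fallingFactorial x (suc n) = (x - + n) * fallingFactorial x n

fallingFactorial-pos : ∀ x n → fallingFactorial (+ x) n ≡ + (n ! ℕ.* (x C n))
fallingFactorial-pos x zero    = refl
fallingFactorial-pos x (suc n) = begin
  (+ x - + n) * fallingFactorial (+ x) n
    ≡⟨ cong ((+ x - + n) *_) (trans (fallingFactorial-pos x n) (ℤ.pos-* (n !) (x C n))) ⟩
  (+ x - + n) * (+ (n !) * + (x C n))
    ≡⟨ absorb (+ x) (+ n) (+ (n !)) (+ (x C n)) (+ (x C suc n)) absorption ⟩
  + suc n * + (n !) * + (x C suc n)
    ≡⟨ sym (trans (ℤ.pos-* (suc n ℕ.* n !) (x C suc n)) (cong (_* + (x C suc n)) (ℤ.pos-* (suc n) (n !)))) ⟩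
  + (suc n ! ℕ.* (x C suc n)) ∎
  where
  absorption : + suc n * + (x C suc n) + + n * + (x C n) ≡ + x * + (x C n)
  absorption = begin
    + suc n * + (x C suc n) + + n * + (x C n)
      ≡⟨ sym (cong₂ _+_ (ℤ.pos-* (suc n) (x C suc n)) (ℤ.pos-* n (x C n))) ⟩
    + (suc n ℕ.* (x C suc n)) + + (n ℕ.* (x C n))
      ≡⟨ sym (ℤ.pos-+ (suc n ℕ.* (x C suc n)) (n ℕ.* (x C n))) ⟩
    + (suc n ℕ.* (x C suc n) ℕ.+ n ℕ.* (x C n))
      ≡⟨ cong (λ m → + m) (binomial-absorption x n) ⟩
    + (x ℕ.* (x C n))
      ≡⟨ ℤ.pos-* x (x C n) ⟩
    + x * + (x C n) ∎
  absorb : ∀ x n f a b → (+ 1 + n) * b + n * a ≡ x * a → (x - n) * (f * a) ≡ (+ 1 + n) * f * b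
  absorb x n f a b h = begin
    (x - n) * (f * a)                              ≡⟨ distribute x n f a ⟩
    f * (x * a) - f * (n * a)                      ≡⟨ cong (λ t → f * t - f * (n * a)) (sym h) ⟩
    f * ((+ 1 + n) * b + n * a) - f * (n * a)      ≡⟨ cancel n f a b ⟩
    (+ 1 + n) * f * b                              ∎
    where
    distribute : ∀ x n f a → (x - n) * (f * a) ≡ f * (x * a) - f * (n * a)
    distribute = solve-∀
    cancel : ∀ n f a b → f * ((+ 1 + n) * b + n * a) - f * (n * a) ≡ (+ 1 + n) * f * b
    cancel = solve-∀

stirling1-vanish : ∀ {n k} → n < k → stirling1 n k ≡ 0
stirling1-vanish {zero}  {suc k} _         = refl
stirling1-vanish {suc n} {suc k} (s≤s n<k) = trans
  (cong₂ (λ p q → n ℕ.* p ℕ.+ q) (stirling1-vanish (ℕ.m<n⇒m<1+n n<k)) (stirling1-vanish n<k))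
  (cong (ℕ._+ 0) (ℕ.*-zeroʳ n))

signedStirling1 : ℕ → ℕ → ℤ
signedStirling1 n k = (- + 1) ^ (n ∸ k) * + stirling1 n k

signedStirling1-vanish : ∀ {n k} → n < k → signedStirling1 n k ≡ + 0
signedStirling1-vanish {n} {k} n<k =
  trans (cong (λ s → (- + 1) ^ (n ∸ k) * + s) (stirling1-vanish n<k)) (ℤ.*-zeroʳ ((- + 1) ^ (n ∸ k)))

signedStirling1-suc-zero : ∀ n → signedStirling1 (suc n) 0 ≡ + 0
signedStirling1-suc-zero n = ℤ.*-zeroʳ ((- + 1) ^ suc n)

signedStirling1-suc : ∀ n k →
  signedStirling1 (suc n) (suc k) ≡ signedStirling1 n k - + n * signedStirling1 n (suc k)
signedStirling1-suc n k with ℕ.<-≤-connex k n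
... | inj₁ k<n = begin
  σ (n ∸ k) * + (n ℕ.* stirling1 n (suc k) ℕ.+ stirling1 n k)
    ≡⟨ cong₂ _*_ (cong σ (ℕ.+-∸-assoc 1 k<n))
                 (trans (ℤ.pos-+ (n ℕ.* stirling1 n (suc k)) _) (cong (_+ + stirling1 n k) (ℤ.pos-* n _))) ⟩
  σ (suc (n ∸ suc k)) * (+ n * + stirling1 n (suc k) + + stirling1 n k)
    ≡⟨ alternate (σ (n ∸ suc k)) (+ n) (+ stirling1 n (suc k)) (+ stirling1 n k) ⟩
  σ (suc (n ∸ suc k)) * + stirling1 n k - + n * signedStirling1 n (suc k)
    ≡⟨ cong (λ e → σ e * + stirling1 n k - + n * signedStirling1 n (suc k)) (sym (ℕ.+-∸-assoc 1 k<n)) ⟩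
  signedStirling1 n k - + n * signedStirling1 n (suc k) ∎
  where
  σ : ℕ → ℤ
  σ e = (- + 1) ^ e
  alternate : ∀ s n a b → (- + 1 * s) * (n * a + b) ≡ (- + 1 * s) * b - n * (s * a)
  alternate = solve-∀
... | inj₂ n≤k = begin
  (- + 1) ^ (n ∸ k) * + (n ℕ.* stirling1 n (suc k) ℕ.+ stirling1 n k)
    ≡⟨ cong (λ s → (- + 1) ^ (n ∸ k) * + (n ℕ.* s ℕ.+ stirling1 n k)) (stirling1-vanish (s≤s n≤k)) ⟩
  (- + 1) ^ (n ∸ k) * + (n ℕ.* 0 ℕ.+ stirling1 n k)
    ≡⟨ cong (λ m → (- + 1) ^ (n ∸ k) * + (m ℕ.+ stirling1 n k)) (ℕ.*-zeroʳ n) ⟩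
  signedStirling1 n k
    ≡⟨ sym (drop (signedStirling1 n k) (+ n)) ⟩
  signedStirling1 n k - + n * + 0
    ≡⟨ cong (λ t → signedStirling1 n k - + n * t) (sym (signedStirling1-vanish (s≤s n≤k))) ⟩
  signedStirling1 n k - + n * signedStirling1 n (suc k) ∎
  where
  drop : ∀ s n → s - n * + 0 ≡ s
  drop = solve-∀

n*signedStirling1[n,0]≡0 : ∀ n → + n * signedStirling1 n 0 ≡ + 0
n*signedStirling1[n,0]≡0 zero    = refl
n*signedStirling1[n,0]≡0 (suc n) = trans (cong (+ suc n *_) (signedStirling1-suc-zero n)) (ℤ.*-zeroʳ (+ suc n))

∑-signedStirling1-tail : ∀ n x → ∑[ k < suc n ] signedStirling1 n (suc k) * x ^ suc k
                                  ≡ (∑[ k < suc n ] signedStirling1 n k * x ^ k) - signedStirling1 n 0 * + 1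
∑-signedStirling1-tail n x = begin
  ∑[ k < suc n ] p (suc k)                   ≡⟨ add-sub (p 0) (∑[ k < suc n ] p (suc k)) ⟩
  p 0 + (∑[ k < suc n ] p (suc k)) - p 0     ≡⟨ cong (_- p 0) (sym (∑<-suc (suc n) p)) ⟩
  ∑< (suc (suc n)) p - p 0                   ≡⟨ cong (_- p 0) (∑<-last (suc n) p) ⟩
  ∑< (suc n) p + p (suc n) - p 0
    ≡⟨ cong (λ t → ∑< (suc n) p + t - p 0)
            (trans (cong (_* x ^ suc n) (signedStirling1-vanish (ℕ.n<1+n n))) (ℤ.*-zeroˡ (x ^ suc n))) ⟩
  ∑< (suc n) p + + 0 - p 0                   ≡⟨ cong (_- p 0) (ℤ.+-identityʳ (∑< (suc n) p)) ⟩
  ∑< (suc n) p - p 0                         ∎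
  where
  p : ℕ → ℤ
  p k = signedStirling1 n k * x ^ k
  add-sub : ∀ a b → b ≡ a + b - a
  add-sub = solve-∀

fallingFactorial≡∑ : ∀ x n → fallingFactorial x n ≡ ∑[ k < suc n ] signedStirling1 n k * x ^ k
fallingFactorial≡∑ x zero    = refl
fallingFactorial≡∑ x (suc n) = sym (begin
  ∑[ k < suc (suc n) ] signedStirling1 (suc n) k * x ^ k
    ≡⟨ ∑<-suc (suc n) (λ k → signedStirling1 (suc n) k * x ^ k) ⟩
  signedStirling1 (suc n) 0 * + 1 + (∑[ k < suc n ] signedStirling1 (suc n) (suc k) * x ^ suc k)
    ≡⟨ cong₂ _+_ (cong (_* + 1) (signedStirling1-suc-zero n)) (∑-cong (upTo (suc n)) expand) ⟩
  + 0 + (∑[ k < suc n ] (x * p k + - + n * p (suc k)))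
    ≡⟨ trans (ℤ.+-identityˡ _) (∑-+ (upTo (suc n)) (λ k → x * p k) (λ k → - + n * p (suc k))) ⟩
  (∑[ k < suc n ] x * p k) + (∑[ k < suc n ] - + n * p (suc k))
    ≡⟨ cong₂ _+_ (∑-*ˡ (upTo (suc n)) x p) (∑-*ˡ (upTo (suc n)) (- + n) (p ∘ suc)) ⟩
  x * P + - + n * (∑[ k < suc n ] p (suc k))
    ≡⟨ cong (λ t → x * P + - + n * t) (∑-signedStirling1-tail n x) ⟩
  x * P + - + n * (P - signedStirling1 n 0 * + 1)
    ≡⟨ collect x (+ n) P (signedStirling1 n 0) ⟩
  (x - + n) * P + + n * signedStirling1 n 0
    ≡⟨ trans (cong (_+_ ((x - + n) * P)) (n*signedStirling1[n,0]≡0 n)) (ℤ.+-identityʳ _) ⟩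
  (x - + n) * P
    ≡⟨ cong ((x - + n) *_) (sym (fallingFactorial≡∑ x n)) ⟩
  fallingFactorial x (suc n) ∎)
  where
  p : ℕ → ℤ
  p k = signedStirling1 n k * x ^ k
  P : ℤ
  P = ∑[ k < suc n ] p k
  expand : ∀ k → signedStirling1 (suc n) (suc k) * x ^ suc k ≡ x * p k + - + n * p (suc k)
  expand k = trans (cong (_* x ^ suc k) (signedStirling1-suc n k))
                   (distribute (signedStirling1 n k) (+ n) (signedStirling1 n (suc k)) x (x ^ k))
    where
    distribute : ∀ a n b x y → (a - n * b) * (x * y) ≡ x * (a * y) + - n * (b * (x * y))
    distribute = solve-∀
  collect : ∀ x n P s → x * P + - n * (P - s * + 1) ≡ (x - n) * P + n * s
  collect = solve-∀

-- Counting 0/1 matrices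

bits : List Bool
bits = true ∷ false ∷ []

∑-bitvecs-suc : ∀ k (f : Vec Bool (suc k) → ℤ) →
                ∑ (vecs bits (suc k)) f
                ≡ (∑[ v ∈ vecs bits k ] f (true ∷ v)) + (∑[ v ∈ vecs bits k ] f (false ∷ v))
∑-bitvecs-suc k f =
  trans (∑-vecs-suc bits k f) (cong (_+_ (∑[ v ∈ vecs bits k ] f (true ∷ v))) (ℤ.+-identityʳ _))

onesRow-zeros : ∀ m → onesRow (replicate m false) ≡ 0
onesRow-zeros zero    = refl
onesRow-zeros (suc m) = onesRow-zeros m

∑-split-nonzero : ∀ m (h : Vec Bool m → ℤ) →
  ∑ (vecs bits m) h ≡ (∑[ v ∈ vecs bits m ] (if nonzero v then h v else + 0)) + h (replicate m false)
∑-split-nonzero zero    h = trans (ℤ.+-identityʳ (h [])) (sym (ℤ.+-identityˡ (h [])))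
∑-split-nonzero (suc m) h = begin
  ∑ (vecs bits (suc m)) h
    ≡⟨ ∑-bitvecs-suc m h ⟩
  T + (∑[ v ∈ vecs bits m ] h (false ∷ v))
    ≡⟨ cong (_+_ T) (∑-split-nonzero m (h ∘ (false ∷_))) ⟩
  T + (F + h (false ∷ replicate m false))
    ≡⟨ sym (ℤ.+-assoc T F _) ⟩
  T + F + h (replicate (suc m) false)
    ≡⟨ cong (_+ h (replicate (suc m) false)) (sym (∑-bitvecs-suc m (λ v → if nonzero v then h v else + 0))) ⟩
  (∑[ v ∈ vecs bits (suc m) ] (if nonzero v then h v else + 0)) + h (replicate (suc m) false) ∎
  where
  T = ∑[ v ∈ vecs bits m ] h (true ∷ v)
  F = ∑[ v ∈ vecs bits m ] (if nonzero v then h (false ∷ v) else + 0)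

∑-𝟙-guard : ∀ (xs : List A) b (p q : A → Bool) →
            ∑[ x ∈ xs ] 𝟙 (p x ∧ (b ∧ q x)) ≡ (if b then ∑[ x ∈ xs ] 𝟙 (p x ∧ q x) else + 0)
∑-𝟙-guard xs true  p q = refl
∑-𝟙-guard xs false p q = trans (∑-cong xs (λ x → cong 𝟙 (𝔹.∧-zeroʳ (p x)))) (∑-zero xs)

-- Q builds its objects line by line from nonzero lines only, P from arbitrary lines; x records
-- what the lines placed so far contribute.  The zero line leaves x unchanged, so peeling off one
-- line turns Q into a forward difference of P.
module _ {m : ℕ} {X : Set} (next : X → Vec Bool m → X)
         (next-zeros : ∀ x → next x (replicate m false) ≡ x)
         (P Q : ℕ → X → ℤ)
         (P-suc : ∀ i x → P (suc i) x ≡ ∑[ v ∈ vecs bits m ] P i (next x v))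
         (Q-zero : ∀ x → Q 0 x ≡ P 0 x)
         (Q-suc : ∀ r x → Q (suc r) x ≡ ∑[ v ∈ vecs bits m ] (if nonzero v then Q r (next x v) else + 0))
         where

  nonzero-sieve : ∀ r x → Q r x ≡ Δ r (λ i → P i x)
  nonzero-sieve zero    x = Q-zero x
  nonzero-sieve (suc r) x = begin
    Q (suc r) x
      ≡⟨ Q-suc r x ⟩
    ∑[ v ∈ vecs bits m ] (if nonzero v then Q r (next x v) else + 0)
      ≡⟨ ∑-cong (vecs bits m) guarded-sieve ⟩
    ∑[ v ∈ vecs bits m ] Δ r (λ i → if nonzero v then P i (next x v) else + 0)
      ≡⟨ sym (Δ-∑ r (vecs bits m) (λ v i → if nonzero v then P i (next x v) else + 0)) ⟩
    Δ r (λ i → ∑[ v ∈ vecs bits m ] (if nonzero v then P i (next x v) else + 0))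
      ≡⟨ Δ-cong r nonzero-lines ⟩
    Δ r (λ i → P (suc i) x - P i x)
      ≡⟨ Δ-- r (λ i → P (suc i) x) (λ i → P i x) ⟩
    Δ (suc r) (λ i → P i x) ∎
    where
    guarded-sieve : ∀ v → (if nonzero v then Q r (next x v) else + 0)
                          ≡ Δ r (λ i → if nonzero v then P i (next x v) else + 0)
    guarded-sieve v with nonzero v
    ... | true  = nonzero-sieve r (next x v)
    ... | false = sym (Δ-zero r)
    nonzero-lines : ∀ i → ∑[ v ∈ vecs bits m ] (if nonzero v then P i (next x v) else + 0) ≡ P (suc i) x - P i x
    nonzero-lines i = begin
      N                                            ≡⟨ add-sub N (P i x) ⟩
      N + P i x - P i x                            ≡⟨ cong (λ y → N + P i y - P i x) (sym (next-zeros x)) ⟩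
      N + P i (next x (replicate m false)) - P i x ≡⟨ cong (_- P i x) (sym (∑-split-nonzero m (λ v → P i (next x v)))) ⟩
      (∑[ v ∈ vecs bits m ] P i (next x v)) - P i x ≡⟨ cong (_- P i x) (sym (P-suc i x)) ⟩
      P (suc i) x - P i x                          ∎
      where
      N = ∑[ v ∈ vecs bits m ] (if nonzero v then P i (next x v) else + 0)
      add-sub : ∀ a b → a ≡ a + b - b
      add-sub = solve-∀

ℕ-eqᵇ-suc : ∀ a b → ℕ-eqᵇ (suc a) (suc b) ≡ ℕ-eqᵇ a b
ℕ-eqᵇ-suc a b = trans (isYes≗does (suc a ℕ.≟ suc b)) (sym (isYes≗does (a ℕ.≟ b)))

-- The offset d accounts for the ones of the lines peeled off so far.
#Bits : (L d n : ℕ) → ℤ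
#Bits L d n = ∑[ v ∈ vecs bits L ] 𝟙 (ℕ-eqᵇ (d ℕ.+ onesRow v) n)

#Bits-suc : ∀ L d n → #Bits (suc L) d n ≡ #Bits L (suc d) n + #Bits L d n
#Bits-suc L d n = trans (∑-bitvecs-suc L (λ v → 𝟙 (ℕ-eqᵇ (d ℕ.+ onesRow v) n)))
  (cong (_+ #Bits L d n) (∑-cong (vecs bits L) (λ v → cong (λ t → 𝟙 (ℕ-eqᵇ t n)) (ℕ.+-suc d (onesRow v)))))

#Bits≡C : ∀ L n → #Bits L 0 n ≡ + (L C n)
#Bits≡C zero    zero    = refl
#Bits≡C zero    (suc n) = refl
#Bits≡C (suc L) zero    = trans (#Bits-suc L 0 0) (cong₂ _+_ (∑-zero (vecs bits L)) (#Bits≡C L 0))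
#Bits≡C (suc L) (suc n) = begin
  #Bits (suc L) 0 (suc n)          ≡⟨ #Bits-suc L 0 (suc n) ⟩
  #Bits L 1 (suc n) + #Bits L 0 (suc n)
    ≡⟨ cong (_+ #Bits L 0 (suc n)) (∑-cong (vecs bits L) (λ v → cong 𝟙 (ℕ-eqᵇ-suc (onesRow v) n))) ⟩
  #Bits L 0 n + #Bits L 0 (suc n)  ≡⟨ cong₂ _+_ (#Bits≡C L n) (#Bits≡C L (suc n)) ⟩
  + (L C n) + + (L C suc n)        ≡⟨ sym (ℤ.pos-+ (L C n) (L C suc n)) ⟩
  + (L C n ℕ.+ L C suc n)          ≡⟨ cong (λ m → + m) (nCk+nC[k+1]≡[n+1]C[k+1] L n) ⟩
  + (suc L C suc n)                ∎

∑-#Bits : ∀ L′ L d n → ∑[ v ∈ vecs bits L′ ] #Bits L (d ℕ.+ onesRow v) n ≡ #Bits (L′ ℕ.+ L) d n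
∑-#Bits zero     L d n = trans (ℤ.+-identityʳ _) (cong (λ e → #Bits L e n) (ℕ.+-identityʳ d))
∑-#Bits (suc L′) L d n = begin
  ∑[ v ∈ vecs bits (suc L′) ] #Bits L (d ℕ.+ onesRow v) n
    ≡⟨ ∑-bitvecs-suc L′ (λ v → #Bits L (d ℕ.+ onesRow v) n) ⟩
  (∑[ v ∈ vecs bits L′ ] #Bits L (d ℕ.+ suc (onesRow v)) n) + (∑[ v ∈ vecs bits L′ ] #Bits L (d ℕ.+ onesRow v) n)
    ≡⟨ cong (_+ (∑[ v ∈ vecs bits L′ ] #Bits L (d ℕ.+ onesRow v) n))
            (∑-cong (vecs bits L′) (λ v → cong (λ e → #Bits L e n) (ℕ.+-suc d (onesRow v)))) ⟩
  (∑[ v ∈ vecs bits L′ ] #Bits L (suc d ℕ.+ onesRow v) n) + (∑[ v ∈ vecs bits L′ ] #Bits L (d ℕ.+ onesRow v) n)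
    ≡⟨ cong₂ _+_ (∑-#Bits L′ L (suc d) n) (∑-#Bits L′ L d n) ⟩
  #Bits (L′ ℕ.+ L) (suc d) n + #Bits (L′ ℕ.+ L) d n
    ≡⟨ sym (#Bits-suc (L′ ℕ.+ L) d n) ⟩
  #Bits (suc L′ ℕ.+ L) d n ∎

#Mat : (m c d n : ℕ) → ℤ
#Mat m c d n = ∑[ M ∈ allMat01 m c ] 𝟙 (ℕ-eqᵇ (d ℕ.+ ones M) n)

#Mat≡#Bits : ∀ m c d n → #Mat m c d n ≡ #Bits (m ℕ.* c) d n
#Mat≡#Bits zero    c d n = refl
#Mat≡#Bits (suc m) c d n = begin
  #Mat (suc m) c d n
    ≡⟨ ∑-vecs-suc (vecs bits c) m (λ M → 𝟙 (ℕ-eqᵇ (d ℕ.+ ones M) n)) ⟩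
  ∑[ v ∈ vecs bits c ] ∑[ M ∈ allMat01 m c ] 𝟙 (ℕ-eqᵇ (d ℕ.+ (onesRow v ℕ.+ ones M)) n)
    ≡⟨ ∑-cong (vecs bits c) (λ v → ∑-cong (allMat01 m c) (λ M →
         cong (λ t → 𝟙 (ℕ-eqᵇ t n)) (sym (ℕ.+-assoc d (onesRow v) (ones M))))) ⟩
  ∑[ v ∈ vecs bits c ] #Mat m c (d ℕ.+ onesRow v) n
    ≡⟨ ∑-cong (vecs bits c) (λ v → #Mat≡#Bits m c (d ℕ.+ onesRow v) n) ⟩
  ∑[ v ∈ vecs bits c ] #Bits (m ℕ.* c) (d ℕ.+ onesRow v) n
    ≡⟨ ∑-#Bits c (m ℕ.* c) d n ⟩
  #Bits (c ℕ.+ m ℕ.* c) d n ∎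

#Mat≡C : ∀ m c n → #Mat m c 0 n ≡ + ((m ℕ.* c) C n)
#Mat≡C m c n = trans (#Mat≡#Bits m c 0 n) (#Bits≡C (m ℕ.* c) n)

∑-allMat01-suc-col : ∀ m c (F : Mat01 m (suc c) → ℤ) →
  ∑ (allMat01 m (suc c)) F ≡ ∑[ col ∈ vecs bits m ] ∑[ M ∈ allMat01 m c ] F (zipWith _∷_ col M)
∑-allMat01-suc-col zero    c F = sym (ℤ.+-identityʳ _)
∑-allMat01-suc-col (suc m) c F = begin
  ∑ (allMat01 (suc m) (suc c)) F
    ≡⟨ ∑-vecs-suc (vecs bits (suc c)) m F ⟩
  ∑[ row ∈ vecs bits (suc c) ] ∑[ M ∈ allMat01 m (suc c) ] F (row ∷ M)
    ≡⟨ ∑-vecs-suc bits c _ ⟩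
  ∑[ b ∈ bits ] ∑[ row ∈ vecs bits c ] ∑[ M ∈ allMat01 m (suc c) ] F ((b ∷ row) ∷ M)
    ≡⟨ ∑-cong bits (λ b → ∑-cong (vecs bits c) (λ row →
         ∑-allMat01-suc-col m c (λ M → F ((b ∷ row) ∷ M)))) ⟩
  ∑[ b ∈ bits ] ∑[ row ∈ vecs bits c ] ∑[ col ∈ vecs bits m ] ∑[ M ∈ allMat01 m c ] F ((b ∷ row) ∷ zipWith _∷_ col M)
    ≡⟨ ∑-cong bits (λ b → ∑-swap (vecs bits c) (vecs bits m)
                                 (λ row col → ∑[ M ∈ allMat01 m c ] F ((b ∷ row) ∷ zipWith _∷_ col M))) ⟩
  ∑[ b ∈ bits ] ∑[ col ∈ vecs bits m ] ∑[ row ∈ vecs bits c ] ∑[ M ∈ allMat01 m c ] F ((b ∷ row) ∷ zipWith _∷_ col M)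
    ≡⟨ ∑-cong bits (λ b → ∑-cong (vecs bits m) (λ col →
         sym (∑-vecs-suc (vecs bits c) m (λ M → F (zipWith _∷_ (b ∷ col) M))))) ⟩
  ∑[ b ∈ bits ] ∑[ col ∈ vecs bits m ] ∑[ M ∈ allMat01 (suc m) c ] F (zipWith _∷_ (b ∷ col) M)
    ≡⟨ sym (∑-vecs-suc bits m _) ⟩
  ∑[ col ∈ vecs bits (suc m) ] ∑[ M ∈ allMat01 (suc m) c ] F (zipWith _∷_ col M) ∎

ones-zipWith-∷ : ∀ {m c} (col : Vec Bool m) (M : Mat01 m c) → ones (zipWith _∷_ col M) ≡ onesRow col ℕ.+ ones M
ones-zipWith-∷ []        []      = refl
ones-zipWith-∷ (b ∷ col) (r ∷ M) = trans (cong (onesRow (b ∷ r) ℕ.+_) (ones-zipWith-∷ col M)) (swap b)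
  where
  swap : ∀ b → onesRow (b ∷ r) ℕ.+ (onesRow col ℕ.+ ones M) ≡ onesRow (b ∷ col) ℕ.+ (onesRow r ℕ.+ ones M)
  swap true  = cong suc (ℕ+.x∙yz≈y∙xz (onesRow r) (onesRow col) (ones M))
  swap false = ℕ+.x∙yz≈y∙xz (onesRow r) (onesRow col) (ones M)

transpose-zipWith-∷ : ∀ {m c} (col : Vec Bool m) (M : Mat01 m c) →
                      Vec.transpose (zipWith _∷_ col M) ≡ col ∷ Vec.transpose M
transpose-zipWith-∷ []        []      = refl
transpose-zipWith-∷ (b ∷ col) (r ∷ M) rewrite transpose-zipWith-∷ col M = refl

noZeroCol-zipWith-∷ : ∀ {m c} (col : Vec Bool m) (M : Mat01 m c) →
                      noZeroCol (zipWith _∷_ col M) ≡ nonzero col ∧ noZeroCol M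
noZeroCol-zipWith-∷ col M = cong (allᵥ nonzero) (transpose-zipWith-∷ col M)

noZeroCol-empty : ∀ {m} (M : Mat01 m 0) → noZeroCol M ≡ true
noZeroCol-empty M with Vec.transpose M
... | [] = refl

#MatNoZeroCol : (m c d n : ℕ) → ℤ
#MatNoZeroCol m c d n = ∑[ M ∈ allMat01 m c ] 𝟙 (ℕ-eqᵇ (d ℕ.+ ones M) n ∧ noZeroCol M)

ℕ-eqᵇ-ones-zipWith-∷ : ∀ {m c} d n (col : Vec Bool m) (M : Mat01 m c) →
  ℕ-eqᵇ (d ℕ.+ ones (zipWith _∷_ col M)) n ≡ ℕ-eqᵇ (d ℕ.+ onesRow col ℕ.+ ones M) n
ℕ-eqᵇ-ones-zipWith-∷ d n col M = cong (λ t → ℕ-eqᵇ t n)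
  (trans (cong (d ℕ.+_) (ones-zipWith-∷ col M)) (sym (ℕ.+-assoc d (onesRow col) (ones M))))

#Mat-suc-col : ∀ m c d n → #Mat m (suc c) d n ≡ ∑[ col ∈ vecs bits m ] #Mat m c (d ℕ.+ onesRow col) n
#Mat-suc-col m c d n = trans (∑-allMat01-suc-col m c (λ M → 𝟙 (ℕ-eqᵇ (d ℕ.+ ones M) n)))
  (∑-cong (vecs bits m) (λ col → ∑-cong (allMat01 m c) (λ M → cong 𝟙 (ℕ-eqᵇ-ones-zipWith-∷ d n col M))))

#MatNoZeroCol-zero-col : ∀ m d n → #MatNoZeroCol m 0 d n ≡ #Mat m 0 d n
#MatNoZeroCol-zero-col m d n = ∑-cong (allMat01 m 0) (λ M →
  cong 𝟙 (trans (cong (ℕ-eqᵇ (d ℕ.+ ones M) n ∧_) (noZeroCol-empty M)) (𝔹.∧-identityʳ _)))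

#MatNoZeroCol-suc-col : ∀ m c d n → #MatNoZeroCol m (suc c) d n
  ≡ ∑[ col ∈ vecs bits m ] (if nonzero col then #MatNoZeroCol m c (d ℕ.+ onesRow col) n else + 0)
#MatNoZeroCol-suc-col m c d n =
  trans (∑-allMat01-suc-col m c (λ M → 𝟙 (ℕ-eqᵇ (d ℕ.+ ones M) n ∧ noZeroCol M)))
        (∑-cong (vecs bits m) (λ col → trans (∑-cong (allMat01 m c) (λ M → cong 𝟙
          (cong₂ _∧_ (ℕ-eqᵇ-ones-zipWith-∷ d n col M) (noZeroCol-zipWith-∷ col M))))
          (∑-𝟙-guard (allMat01 m c) (nonzero col) (λ M → ℕ-eqᵇ (d ℕ.+ onesRow col ℕ.+ ones M) n) noZeroCol)))

G-cols≡Δ : ∀ m n c → + G-cols m n c ≡ Δ c (λ j → + ((m ℕ.* j) C n))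
G-cols≡Δ m n c = begin
  + G-cols m n c
    ≡⟨ pos-count (λ M → ℕ-eqᵇ (ones M) n ∧ noZeroCol M) (allMat01 m c) ⟩
  #MatNoZeroCol m c 0 n
    ≡⟨ nonzero-sieve {m} (λ d col → d ℕ.+ onesRow col) no-ones
                     (λ j d → #Mat m j d n) (λ j d → #MatNoZeroCol m j d n)
                     (λ j d → #Mat-suc-col m j d n) (λ d → #MatNoZeroCol-zero-col m d n)
                     (λ j d → #MatNoZeroCol-suc-col m j d n) c 0 ⟩
  Δ c (λ j → #Mat m j 0 n)
    ≡⟨ Δ-cong c (λ j → #Mat≡C m j n) ⟩
  Δ c (λ j → + ((m ℕ.* j) C n)) ∎
  where
  no-ones : ∀ d → d ℕ.+ onesRow (replicate m false) ≡ d
  no-ones d = trans (cong (d ℕ.+_) (onesRow-zeros m)) (ℕ.+-identityʳ d)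

-- The columns marked in u are exempt from being nonzero.
noZeroColExcept : ∀ {r c} → Vec Bool c → Mat01 r c → Bool
noZeroColExcept u M = allᵥ nonzero (zipWith _∷_ u (Vec.transpose M))

noZeroColExcept-zeros : ∀ {r c} (M : Mat01 r c) → noZeroColExcept (replicate c false) M ≡ noZeroCol M
noZeroColExcept-zeros M = unmarked (Vec.transpose M)
  where
  unmarked : ∀ {c r} (T : Vec (Vec Bool r) c) → allᵥ nonzero (zipWith _∷_ (replicate c false) T) ≡ allᵥ nonzero T
  unmarked []      = refl
  unmarked (t ∷ T) = cong (nonzero t ∧_) (unmarked T)

noZeroColExcept-∷ : ∀ {r c} (u v : Vec Bool c) (M : Mat01 r c) →
                    noZeroColExcept u (v ∷ M) ≡ noZeroColExcept (zipWith _∨_ u v) M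
noZeroColExcept-∷ u v M =
  trans (cong (λ T → allᵥ nonzero (zipWith _∷_ u T)) (sym (Vec.zipWith-is-⊛ _∷_ v (Vec.transpose M))))
        (merge u v (Vec.transpose M))
  where
  nonzero-∨ : ∀ {r} a b (t : Vec Bool r) → nonzero (a ∷ b ∷ t) ≡ nonzero ((a ∨ b) ∷ t)
  nonzero-∨ true  b t = refl
  nonzero-∨ false b t = refl
  merge : ∀ {c r} (u v : Vec Bool c) (T : Vec (Vec Bool r) c) →
          allᵥ nonzero (zipWith _∷_ u (zipWith _∷_ v T)) ≡ allᵥ nonzero (zipWith _∷_ (zipWith _∨_ u v) T)
  merge []      []      []      = refl
  merge (a ∷ u) (b ∷ v) (t ∷ T) = cong₂ _∧_ (nonzero-∨ a b t) (merge u v T)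

#MatExcept : (r c : ℕ) → Vec Bool c × ℕ → ℕ → ℤ
#MatExcept r c (u , d) n = ∑[ M ∈ allMat01 r c ] 𝟙 (ℕ-eqᵇ (d ℕ.+ ones M) n ∧ noZeroColExcept u M)

#MatNoZeroRowExcept : (r c : ℕ) → Vec Bool c × ℕ → ℕ → ℤ
#MatNoZeroRowExcept r c (u , d) n =
  ∑[ M ∈ allMat01 r c ] 𝟙 (ℕ-eqᵇ (d ℕ.+ ones M) n ∧ (noZeroRow M ∧ noZeroColExcept u M))

addRow : ∀ {c} → Vec Bool c × ℕ → Vec Bool c → Vec Bool c × ℕ
addRow (u , d) v = zipWith _∨_ u v , d ℕ.+ onesRow v

addRow-zeros : ∀ {c} (x : Vec Bool c × ℕ) → addRow x (replicate c false) ≡ x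
addRow-zeros {c} (u , d) = cong₂ _,_ (Vec.zipWith-identityʳ 𝔹.∨-identityʳ u)
                                     (trans (cong (d ℕ.+_) (onesRow-zeros c)) (ℕ.+-identityʳ d))

#MatExcept-suc : ∀ r c x n → #MatExcept (suc r) c x n ≡ ∑[ v ∈ vecs bits c ] #MatExcept r c (addRow x v) n
#MatExcept-suc r c (u , d) n =
  trans (∑-vecs-suc (vecs bits c) r (λ M → 𝟙 (ℕ-eqᵇ (d ℕ.+ ones M) n ∧ noZeroColExcept u M)))
        (∑-cong (vecs bits c) (λ v → ∑-cong (allMat01 r c) (λ M → cong 𝟙
          (cong₂ _∧_ (cong (λ t → ℕ-eqᵇ t n) (sym (ℕ.+-assoc d (onesRow v) (ones M))))
                     (noZeroColExcept-∷ u v M)))))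

#MatNoZeroRowExcept-suc : ∀ r c x n → #MatNoZeroRowExcept (suc r) c x n
  ≡ ∑[ v ∈ vecs bits c ] (if nonzero v then #MatNoZeroRowExcept r c (addRow x v) n else + 0)
#MatNoZeroRowExcept-suc r c (u , d) n =
  trans (∑-vecs-suc (vecs bits c) r (λ M → 𝟙 (ℕ-eqᵇ (d ℕ.+ ones M) n ∧ (noZeroRow M ∧ noZeroColExcept u M))))
        (∑-cong (vecs bits c) (λ v → trans (∑-cong (allMat01 r c) (λ M → cong 𝟙
          (cong₂ _∧_ (cong (λ t → ℕ-eqᵇ t n) (sym (ℕ.+-assoc d (onesRow v) (ones M))))
                     (trans (𝔹.∧-assoc (nonzero v) (noZeroRow M) _)
                            (cong (λ b → nonzero v ∧ noZeroRow M ∧ b) (noZeroColExcept-∷ u v M))))))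
          (∑-𝟙-guard (allMat01 r c) (nonzero v) (λ M → ℕ-eqᵇ (d ℕ.+ onesRow v ℕ.+ ones M) n)
                     (λ M → noZeroRow M ∧ noZeroColExcept (zipWith _∨_ u v) M))))

M-rc≡Δ : ∀ n r c → + M-rc n r c ≡ Δ r (λ i → + G-cols i n c)
M-rc≡Δ n r c = begin
  + M-rc n r c
    ≡⟨ pos-count (λ M → ℕ-eqᵇ (ones M) n ∧ noZeroRow M ∧ noZeroCol M) (allMat01 r c) ⟩
  ∑[ M ∈ allMat01 r c ] 𝟙 (ℕ-eqᵇ (ones M) n ∧ noZeroRow M ∧ noZeroCol M)
    ≡⟨ ∑-cong (allMat01 r c) (λ M →
         cong (λ b → 𝟙 (ℕ-eqᵇ (ones M) n ∧ noZeroRow M ∧ b)) (sym (noZeroColExcept-zeros M))) ⟩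
  #MatNoZeroRowExcept r c (replicate c false , 0) n
    ≡⟨ nonzero-sieve addRow addRow-zeros
                     (λ i x → #MatExcept i c x n) (λ i x → #MatNoZeroRowExcept i c x n)
                     (λ i x → #MatExcept-suc i c x n) (λ x → refl)
                     (λ i x → #MatNoZeroRowExcept-suc i c x n) r (replicate c false , 0) ⟩
  Δ r (λ i → #MatExcept i c (replicate c false , 0) n)
    ≡⟨ Δ-cong r (λ i → trans
         (∑-cong (allMat01 i c) (λ M → cong (λ b → 𝟙 (ℕ-eqᵇ (ones M) n ∧ b)) (noZeroColExcept-zeros M)))
         (sym (pos-count (λ M → ℕ-eqᵇ (ones M) n ∧ noZeroCol M) (allMat01 i c)))) ⟩
  Δ r (λ i → + G-cols i n c) ∎

^-distrib-* : ∀ (x y : ℤ) k → (x * y) ^ k ≡ x ^ k * y ^ k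
^-distrib-* x y zero    = refl
^-distrib-* x y (suc k) = trans (cong (x * y *_) (^-distrib-* x y k)) (ℤ*.interchange x y (x ^ k) (y ^ k))

Δ-polynomial : ∀ c n (a : ℕ → ℤ) →
               Δ c (λ j → ∑[ k < suc n ] a k * (+ j) ^ k) ≡ ∑[ k < suc n ] a k * + surjections k c
Δ-polynomial c n a = begin
  Δ c (λ j → ∑[ k < suc n ] a k * (+ j) ^ k)
    ≡⟨ Δ-∑ c (upTo (suc n)) (λ k j → a k * (+ j) ^ k) ⟩
  ∑[ k < suc n ] Δ c (λ j → a k * (+ j) ^ k)
    ≡⟨ ∑-cong (upTo (suc n)) (λ k → trans (Δ-*ˡ c (a k) (λ j → (+ j) ^ k))
                                          (cong (a k *_) (sym (surjections≡Δ k c)))) ⟩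
  ∑[ k < suc n ] a k * + surjections k c ∎

n!*G-cols≡∑ : ∀ m n c →
  + (n !) * + G-cols m n c ≡ ∑[ k < suc n ] (signedStirling1 n k * (+ m) ^ k) * + surjections k c
n!*G-cols≡∑ m n c = begin
  + (n !) * + G-cols m n c
    ≡⟨ cong (+ (n !) *_) (G-cols≡Δ m n c) ⟩
  + (n !) * Δ c (λ j → + ((m ℕ.* j) C n))
    ≡⟨ sym (Δ-*ˡ c (+ (n !)) (λ j → + ((m ℕ.* j) C n))) ⟩
  Δ c (λ j → + (n !) * + ((m ℕ.* j) C n))
    ≡⟨ Δ-cong c stirling-expansion ⟩
  Δ c (λ j → ∑[ k < suc n ] (signedStirling1 n k * (+ m) ^ k) * (+ j) ^ k)
    ≡⟨ Δ-polynomial c n (λ k → signedStirling1 n k * (+ m) ^ k) ⟩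
  ∑[ k < suc n ] (signedStirling1 n k * (+ m) ^ k) * + surjections k c ∎
  where
  split-power : ∀ j k → signedStirling1 n k * (+ (m ℕ.* j)) ^ k ≡ signedStirling1 n k * (+ m) ^ k * (+ j) ^ k
  split-power j k = begin
    signedStirling1 n k * (+ (m ℕ.* j)) ^ k   ≡⟨ cong (λ t → signedStirling1 n k * t ^ k) (ℤ.pos-* m j) ⟩
    signedStirling1 n k * (+ m * + j) ^ k     ≡⟨ cong (signedStirling1 n k *_) (^-distrib-* (+ m) (+ j) k) ⟩
    signedStirling1 n k * ((+ m) ^ k * (+ j) ^ k) ≡⟨ sym (ℤ.*-assoc (signedStirling1 n k) _ _) ⟩
    signedStirling1 n k * (+ m) ^ k * (+ j) ^ k ∎
  stirling-expansion : ∀ j → + (n !) * + ((m ℕ.* j) C n)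
                             ≡ ∑[ k < suc n ] (signedStirling1 n k * (+ m) ^ k) * (+ j) ^ k
  stirling-expansion j = begin
    + (n !) * + ((m ℕ.* j) C n)             ≡⟨ sym (ℤ.pos-* (n !) ((m ℕ.* j) C n)) ⟩
    + (n ! ℕ.* ((m ℕ.* j) C n))              ≡⟨ sym (fallingFactorial-pos (m ℕ.* j) n) ⟩
    fallingFactorial (+ (m ℕ.* j)) n        ≡⟨ fallingFactorial≡∑ (+ (m ℕ.* j)) n ⟩
    ∑[ k < suc n ] signedStirling1 n k * (+ (m ℕ.* j)) ^ k
      ≡⟨ ∑-cong (upTo (suc n)) (split-power j) ⟩
    ∑[ k < suc n ] (signedStirling1 n k * (+ m) ^ k) * (+ j) ^ k ∎

n!*M-rc≡∑ : ∀ n r c →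
  + (n !) * + M-rc n r c ≡ ∑[ k < suc n ] (signedStirling1 n k * + surjections k c) * + surjections k r
n!*M-rc≡∑ n r c = begin
  + (n !) * + M-rc n r c
    ≡⟨ cong (+ (n !) *_) (M-rc≡Δ n r c) ⟩
  + (n !) * Δ r (λ i → + G-cols i n c)
    ≡⟨ sym (Δ-*ˡ r (+ (n !)) (λ i → + G-cols i n c)) ⟩
  Δ r (λ i → + (n !) * + G-cols i n c)
    ≡⟨ Δ-cong r (λ i → trans (n!*G-cols≡∑ i n c) (∑-cong (upTo (suc n)) (λ k →
         ℤ*.xy∙z≈xz∙y (signedStirling1 n k) ((+ i) ^ k) (+ surjections k c)))) ⟩
  Δ r (λ i → ∑[ k < suc n ] (signedStirling1 n k * + surjections k c) * (+ i) ^ k)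
    ≡⟨ Δ-polynomial r n (λ k → signedStirling1 n k * + surjections k c) ⟩
  ∑[ k < suc n ] (signedStirling1 n k * + surjections k c) * + surjections k r ∎

∑-∑-surjections≡∑-fub : ∀ {n N} → n ≤ N → (a : ℕ → ℤ) →
  ∑[ c < suc N ] ∑[ k < suc n ] a k * + surjections k c ≡ ∑[ k < suc n ] a k * + fub k
∑-∑-surjections≡∑-fub {n} {N} n≤N a = begin
  ∑[ c < suc N ] ∑[ k < suc n ] a k * + surjections k c
    ≡⟨ ∑-swap (upTo (suc N)) (upTo (suc n)) (λ c k → a k * + surjections k c) ⟩
  ∑[ k < suc n ] ∑[ c < suc N ] a k * + surjections k c
    ≡⟨ ∑<-cong (suc n) (λ k k<1+n → trans (∑-*ˡ (upTo (suc N)) (a k) (λ c → + surjections k c))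
                                          (cong (a k *_) (∑-surjections≡fub (ℕ.≤-trans (ℕ.≤-pred k<1+n) n≤N)))) ⟩
  ∑[ k < suc n ] a k * + fub k ∎

altSum≡∑ : ∀ n w → altSum n w ≡ ∑[ k < suc n ] (signedStirling1 n k * + w k) * + fub k
altSum≡∑ n w = ∑-cong (upTo (suc n)) (λ k → begin
  (- + 1) ^ (n ∸ k) * + (stirling1 n k ℕ.* fub k ℕ.* w k)
    ≡⟨ cong ((- + 1) ^ (n ∸ k) *_) (trans (ℤ.pos-* (stirling1 n k ℕ.* fub k) (w k))
                                           (cong (_* + w k) (ℤ.pos-* (stirling1 n k) (fub k)))) ⟩
  (- + 1) ^ (n ∸ k) * (+ stirling1 n k * + fub k * + w k)
    ≡⟨ reorder ((- + 1) ^ (n ∸ k)) (+ stirling1 n k) (+ fub k) (+ w k) ⟩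
  (signedStirling1 n k * + w k) * + fub k ∎)
  where
  reorder : ∀ σ s f w → σ * (s * f * w) ≡ σ * s * w * f
  reorder = solve-∀

n!*G01≡altSum : ∀ n m N → n ≤ N → + (n !) * + G01 m n N ≡ altSum n (λ k → m ℕ.^ k)
n!*G01≡altSum n m N n≤N = begin
  + (n !) * + G01 m n N
    ≡⟨ cong (+ (n !) *_) (pos-Σℕ N (G-cols m n)) ⟩
  + (n !) * (∑[ c < suc N ] + G-cols m n c)
    ≡⟨ sym (∑-*ˡ (upTo (suc N)) (+ (n !)) (λ c → + G-cols m n c)) ⟩
  ∑[ c < suc N ] + (n !) * + G-cols m n c
    ≡⟨ ∑-cong (upTo (suc N)) (n!*G-cols≡∑ m n) ⟩
  ∑[ c < suc N ] ∑[ k < suc n ] (signedStirling1 n k * (+ m) ^ k) * + surjections k c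
    ≡⟨ ∑-∑-surjections≡∑-fub n≤N (λ k → signedStirling1 n k * (+ m) ^ k) ⟩
  ∑[ k < suc n ] (signedStirling1 n k * (+ m) ^ k) * + fub k
    ≡⟨ ∑-cong (upTo (suc n)) (λ k → cong (λ t → signedStirling1 n k * t * + fub k) (sym (pos-^ m k))) ⟩
  ∑[ k < suc n ] (signedStirling1 n k * + (m ℕ.^ k)) * + fub k
    ≡⟨ sym (altSum≡∑ n (λ k → m ℕ.^ k)) ⟩
  altSum n (λ k → m ℕ.^ k) ∎

n!*M01≡altSum : ∀ n N → n ≤ N → + (n !) * + M01 n N ≡ altSum n fub
n!*M01≡altSum n N n≤N = begin
  + (n !) * + M01 n N
    ≡⟨ cong (+ (n !) *_) (trans (pos-Σℕ N _) (∑-cong (upTo (suc N)) (λ r → pos-Σℕ N (M-rc n r)))) ⟩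
  + (n !) * (∑[ r < suc N ] ∑[ c < suc N ] + M-rc n r c)
    ≡⟨ sym (trans (∑-cong (upTo (suc N)) (λ r → ∑-*ˡ (upTo (suc N)) (+ (n !)) (λ c → + M-rc n r c)))
                  (∑-*ˡ (upTo (suc N)) (+ (n !)) (λ r → ∑[ c < suc N ] + M-rc n r c))) ⟩
  ∑[ r < suc N ] ∑[ c < suc N ] + (n !) * + M-rc n r c
    ≡⟨ ∑-swap (upTo (suc N)) (upTo (suc N)) (λ r c → + (n !) * + M-rc n r c) ⟩
  ∑[ c < suc N ] ∑[ r < suc N ] + (n !) * + M-rc n r c
    ≡⟨ ∑-cong (upTo (suc N)) (λ c → ∑-cong (upTo (suc N)) (λ r → n!*M-rc≡∑ n r c)) ⟩
  ∑[ c < suc N ] ∑[ r < suc N ] ∑[ k < suc n ] (signedStirling1 n k * + surjections k c) * + surjections k r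
    ≡⟨ ∑-cong (upTo (suc N)) (λ c →
         ∑-∑-surjections≡∑-fub n≤N (λ k → signedStirling1 n k * + surjections k c)) ⟩
  ∑[ c < suc N ] ∑[ k < suc n ] (signedStirling1 n k * + surjections k c) * + fub k
    ≡⟨ ∑-cong (upTo (suc N)) (λ c → ∑-cong (upTo (suc n)) (λ k →
         ℤ*.xy∙z≈xz∙y (signedStirling1 n k) (+ surjections k c) (+ fub k))) ⟩
  ∑[ c < suc N ] ∑[ k < suc n ] (signedStirling1 n k * + fub k) * + surjections k c
    ≡⟨ ∑-∑-surjections≡∑-fub n≤N (λ k → signedStirling1 n k * + fub k) ⟩
  ∑[ k < suc n ] (signedStirling1 n k * + fub k) * + fub k
    ≡⟨ sym (altSum≡∑ n fub) ⟩
  altSum n fub ∎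

proposition6p1 : (n m : ℕ) →
    ((N : ℕ) → n ≤ N → (+ (n !)) * (+ G01 m n N) ≡ altSum n (λ k → m ℕ.^ k))
    × ((N : ℕ) → n ≤ N → (+ (n !)) * (+ M01 n N) ≡ altSum n (λ k → fub k))
proposition6p1 n m = n!*G01≡altSum n m , n!*M01≡altSum n
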